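{- Let $\ell$ and $k$ be integers such that $1 \le \ell < k$, and let $m_1,\ldots,m_k$ be even positive integers such that $m_1+\ldots+m_\ell = m_{\ell+1}+\ldots+m_k$. If $\mathrm{OP}^\ast(m_1,\ldots,m_\ell)$ and $\mathrm{OP}^\ast(m_{\ell+1},\ldots,m_k)$ both have solutions, then $\mathrm{OP}^\ast(m_1,\ldots,m_k)$ has a solution.
   Context: $K_n^\ast$ denotes the complete symmetric digraph of order $n$ (every ordered pair of distinct vertices is an arc; no loops). For integers $m_1,\ldots,m_k \ge 2$ with $n=m_1+\ldots+m_k$, the directed Oberwolfach problem $\mathrm{OP}^\ast(m_1,\ldots,m_k)$ asks for a decomposition of $K_n^\ast$ (a partition of its arc set) into spanning subdigraphs, each of which is a disjoint union of $k$ directed cycles of lengths $m_1,\ldots,m_k$; such a decomposition is a solution. A directed cycle of length 2 consists of two opposite arcs between two vertices. -}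

module Defs where

open import Data.Nat using (ℕ; zero; suc; _≤_; _<_)
open import Data.Nat.DivMod using (_mod_)
open import Data.Fin using (Fin; toℕ)
open import Data.List using (List; length; lookup; take; drop)
open import Data.Nat.ListAction using (sum)
open import Data.Product using (Σ; Σ-syntax; _×_; _,_; proj₁; proj₂)
open import Function.Definitions using (Bijective)
open import Relation.Binary.PropositionalEquality using (_≡_; _≢_)

next : ∀ {m} → Fin m → Fin m
next {suc m} i = suc (toℕ i) mod (suc m)

Pos : List ℕ → Set
Pos ms = Σ (Fin (length ms)) (λ j → Fin (lookup ms j))

-- A spanning subdigraph of K_n^* that is a disjoint union of directed
-- cycles of lengths m_1,…,m_k: cycle j visits vert j 0, vert j 1, …,
-- vert j (m_j - 1) and back; every vertex lies on exactly one cycle at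
-- exactly one position (bijectivity).
record CycleFactor (n : ℕ) (ms : List ℕ) : Set where
  field
    vert : (j : Fin (length ms)) → Fin (lookup ms j) → Fin n
    spanning-disjoint : Bijective {A = Pos ms} _≡_ _≡_ (λ p → vert (proj₁ p) (proj₂ p))

HasArc : ∀ {n ms} → CycleFactor n ms → Fin n → Fin n → Set
HasArc {n} {ms} F u v =
  Σ[ j ∈ Fin (length ms) ] Σ[ i ∈ Fin (lookup ms j) ]
    (CycleFactor.vert F j i ≡ u × CycleFactor.vert F j (next i) ≡ v)

-- A solution of OP^*(ms): a family of such factors of K_n^*, n = sum ms,
-- partitioning the arc set of K_n^*: every factor arc is an arc of K_n^*
-- (no loops), and every arc of K_n^* lies in exactly one factor.
Solution : List ℕ → Set
Solution ms =
  Σ[ t ∈ ℕ ] Σ[ F ∈ (Fin t → CycleFactor (sum ms) ms) ]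
    ((∀ s u v → HasArc (F s) u v → u ≢ v)
    × (∀ u v → u ≢ v →
         Σ[ s ∈ Fin t ] (HasArc (F s) u v
                         × (∀ s′ → HasArc (F s′) u v → s′ ≡ s))))

-- OP^*(ms) has a solution (the m_i ≥ 2 requirement is part of the problem)
OPStar : List ℕ → Set
OPStar ms = Solution ms

-- Put the two given solutions on disjoint copies V₁ and V₂ of a vertex set of
-- size n = m₁ + … + m_ℓ.  Both consist of n − 1 factors, so pairing them yields
-- n − 1 factors of type (m₁, …, m_k) that cover every arc inside V₁ and inside
-- V₂ exactly once.  Since every m_i is even, the cycles of type (m₁, …, m_k) can
-- be laid out so that they alternate between V₁ and V₂; shifting the V₂-vertices
-- of this bipartite factor by each of the n elements of ℤ_n gives n further
-- factors, and because ℤ_n is a Latin square they cover every arc between V₁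
-- and V₂ exactly once.

module Submission where

open import Defs
open import Data.Bool using (Bool; true; false; not)
open import Data.Bool.Properties using (not-involutive)
open import Data.Empty using (⊥-elim)
open import Data.Fin as Fin using (Fin; zero; suc; toℕ; fromℕ; inject₁)
open import Data.Fin.Properties
  using (toℕ-injective; toℕ-fromℕ<; toℕ<n; toℕ-fromℕ; toℕ-inject₁; ¬Fin0; +↔⊎; *↔×;
         cantor-schröder-bernstein)
open import Data.List using (List; []; _∷_; [_]; _++_; take; drop; length)
open import Data.List.Properties using (take++drop≡id)
open import Data.List.Relation.Unary.All as All using (All; []; _∷_)
open import Data.List.Relation.Unary.All.Properties using (++⁺; take⁺; drop⁺)
open import Data.Nat using (ℕ; zero; suc; _+_; _*_; _∸_; _≤_; _<_; _<?_; NonZero)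
open import Data.Nat.DivMod using (_%_; _mod_; m%n<n; m%n%n≡m%n; %-distribˡ-+; n%n≡0; m<n⇒m%n≡m)
open import Data.Nat.Divisibility using (_∣_; divides)
open import Data.Nat.ListAction using (sum)
open import Data.Nat.ListAction.Properties using (sum-++)
open import Data.Nat.Properties
  using (suc-injective; ≤-antisym; ≮⇒≥; <⇒≤; +-comm; +-assoc; m∸n+n≡m; *-cancelʳ-≡;
         *-distribʳ-+; *-suc; *-identityʳ; <-irrefl)
open import Data.Product using (∃-syntax; _×_; _,_; proj₁; proj₂; map₁)
open import Data.Product.Algebra using (×-distribʳ-⊎)
open import Data.Product.Function.NonDependent.Propositional using (_×-↔_)
open import Data.Product.Properties using (,-injectiveˡ; ,-injectiveʳ)
open import Data.Sum using (_⊎_; inj₁; inj₂)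
import Data.Sum as Sum
open import Data.Sum.Function.Propositional using (_⊎-↔_)
open import Data.Sum.Properties using (inj₁-injective; inj₂-injective)
open import Function using (_∘_)
open import Function.Bundles using (_↔_; _↣_; Inverse; Injection; Bijection; mk↔ₛ′; mk⤖; mk↣)
open import Function.Consequences.Propositional using (strictlySurjective⇒surjective)
open import Function.Definitions using (Injective; Bijective; StrictlySurjective)
open import Function.Properties.Bijection using (⤖⇒↔)
open import Function.Properties.Injection using (↣-trans)
open import Function.Properties.Inverse using (↔-trans; ↔-sym; ↔-refl; ↔⇒↣; ↔⇒⤖)
open import Level using (0ℓ)
open import Relation.Binary.PropositionalEquality
  using (_≡_; _≢_; refl; sym; trans; cong; cong₂; subst; module ≡-Reasoning)
open import Relation.Nullary using (yes; no)

open Inverse using (to; from; strictlyInverseˡ; strictlyInverseʳ)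

private
  variable
    X Y P PA PB T T′ V W : Set
    m n t : ℕ
    ms xs ys : List ℕ

to-injective : (I : X ↔ Y) → Injective _≡_ _≡_ (to I)
to-injective I = Injection.injective (↔⇒↣ I)

from-injective : (I : X ↔ Y) → Injective _≡_ _≡_ (from I)
from-injective I = to-injective (↔-sym I)

toℕ-mod : ∀ k n .{{_ : NonZero n}} → toℕ (k mod n) ≡ k % n
toℕ-mod k n = toℕ-fromℕ< (m%n<n k n)

next-cases : (i : Fin m) →
  toℕ (next i) ≡ suc (toℕ i) ⊎ (toℕ (next i) ≡ 0 × suc (toℕ i) ≡ m)
next-cases {suc m} i with suc (toℕ i) <? suc m
... | yes i+1<m = inj₁ (trans (toℕ-mod (suc (toℕ i)) (suc m)) (m<n⇒m%n≡m i+1<m))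
... | no i+1≮m =
  inj₂ (trans (toℕ-mod (suc (toℕ i)) (suc m)) (trans (cong (_% suc m) i+1≡m) (n%n≡0 (suc m))) , i+1≡m)
  where
  i+1≡m : suc (toℕ i) ≡ suc m
  i+1≡m = ≤-antisym (toℕ<n i) (≮⇒≥ i+1≮m)

next-injective : Injective _≡_ _≡_ (next {m})
next-injective {x = i} {j} eq with next-cases i | next-cases j
... | inj₁ i′ | inj₁ j′ = toℕ-injective (suc-injective (trans (sym i′) (trans (cong toℕ eq) j′)))
... | inj₁ i′ | inj₂ (j′ , _) with () ← trans (sym i′) (trans (cong toℕ eq) j′)
... | inj₂ (i′ , _) | inj₁ j′ with () ← trans (sym j′) (trans (cong toℕ (sym eq)) i′)
... | inj₂ (_ , i′) | inj₂ (_ , j′) = toℕ-injective (suc-injective (trans i′ (sym j′)))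

next-surjective : StrictlySurjective _≡_ (next {m})
next-surjective {suc m} zero with next-cases (fromℕ m)
... | inj₁ last↦m+1 = ⊥-elim (<-irrefl refl
        (subst (_< suc m) (trans last↦m+1 (cong suc (toℕ-fromℕ m))) (toℕ<n (next (fromℕ m)))))
... | inj₂ (last↦0 , _) = fromℕ m , toℕ-injective last↦0
next-surjective {suc m} (suc k) with next-cases (inject₁ k)
... | inj₁ k↦k+1 = inject₁ k , toℕ-injective (trans k↦k+1 (cong suc (toℕ-inject₁ k)))
... | inj₂ (_ , k+1≡m) =
  ⊥-elim (<-irrefl (suc-injective (trans (cong suc (sym (toℕ-inject₁ k))) k+1≡m)) (toℕ<n k))

nextPos : ∀ ms → Pos ms → Pos ms
nextPos ms (j , i) = j , next i

nextPos-injective : Injective _≡_ _≡_ (nextPos ms)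
nextPos-injective {ms} {j , i} {j′ , i′} eq with ,-injectiveˡ eq
... | refl = cong (j ,_) (next-injective (position-injective eq))
  where
  position-injective : ∀ {a b} → _≡_ {A = Pos ms} (j , a) (j , b) → a ≡ b
  position-injective refl = refl

nextPos-surjective : StrictlySurjective _≡_ (nextPos ms)
nextPos-surjective (j , k) = let i , i↦k = next-surjective k in (j , i) , cong (j ,_) i↦k

sucPos : ∀ {x} → Pos xs → Pos (x ∷ xs)
sucPos (j , i) = suc j , i

splitPos : ∀ xs ys → Pos (xs ++ ys) → Pos xs ⊎ Pos ys
splitPos [] ys p = inj₂ p
splitPos (x ∷ xs) ys (zero , i) = inj₁ (zero , i)
splitPos (x ∷ xs) ys (suc j , i) = Sum.map₁ sucPos (splitPos xs ys (j , i))

joinPos : ∀ xs ys → Pos xs ⊎ Pos ys → Pos (xs ++ ys)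
joinPos [] ys (inj₂ p) = p
joinPos (x ∷ xs) ys (inj₁ (zero , i)) = zero , i
joinPos (x ∷ xs) ys (inj₁ (suc j , i)) = sucPos (joinPos xs ys (inj₁ (j , i)))
joinPos (x ∷ xs) ys (inj₂ q) = sucPos (joinPos xs ys (inj₂ q))

splitPos-joinPos : ∀ xs ys w → splitPos xs ys (joinPos xs ys w) ≡ w
splitPos-joinPos [] ys (inj₂ p) = refl
splitPos-joinPos (x ∷ xs) ys (inj₁ (zero , i)) = refl
splitPos-joinPos (x ∷ xs) ys (inj₁ (suc j , i)) =
  cong (Sum.map₁ sucPos) (splitPos-joinPos xs ys (inj₁ (j , i)))
splitPos-joinPos (x ∷ xs) ys (inj₂ q) = cong (Sum.map₁ sucPos) (splitPos-joinPos xs ys (inj₂ q))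

joinPos-splitPos : ∀ xs ys p → joinPos xs ys (splitPos xs ys p) ≡ p
joinPos-splitPos [] ys p = refl
joinPos-splitPos (x ∷ xs) ys (zero , i) = refl
joinPos-splitPos (x ∷ xs) ys (suc j , i) with splitPos xs ys (j , i) | joinPos-splitPos xs ys (j , i)
... | inj₁ _ | eq = cong sucPos eq
... | inj₂ _ | eq = cong sucPos eq

splitPos-nextPos : ∀ xs ys p →
  splitPos xs ys (nextPos (xs ++ ys) p) ≡ Sum.map (nextPos xs) (nextPos ys) (splitPos xs ys p)
splitPos-nextPos [] ys p = refl
splitPos-nextPos (x ∷ xs) ys (zero , i) = refl
splitPos-nextPos (x ∷ xs) ys (suc j , i) with splitPos xs ys (j , i) | splitPos-nextPos xs ys (j , i)
... | inj₁ _ | eq = cong (Sum.map₁ sucPos) eq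
... | inj₂ _ | eq = cong (Sum.map₁ sucPos) eq

Pos-++ : ∀ xs ys → Pos (xs ++ ys) ↔ (Pos xs ⊎ Pos ys)
Pos-++ xs ys = mk↔ₛ′ (splitPos xs ys) (joinPos xs ys) (splitPos-joinPos xs ys) (joinPos-splitPos xs ys)

-- A factor with positions (P, σ) on the vertex set V is a bijection I : P ↔ V;
-- its arcs are u → conjugate I σ u.

conjugate : P ↔ V → (P → P) → V → V
conjugate I σ = to I ∘ σ ∘ from I

conjugate-injective : ∀ {σ} (I : P ↔ V) →
                      Injective _≡_ _≡_ σ → Injective _≡_ _≡_ (conjugate I σ)
conjugate-injective I σ-injective = from-injective I ∘ σ-injective ∘ to-injective I

conjugate-surjective : ∀ {σ} (I : P ↔ V) →
                       StrictlySurjective _≡_ σ → StrictlySurjective _≡_ (conjugate I σ)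
conjugate-surjective {σ = σ} I σ-surjective v =
  let p , σp≡ = σ-surjective (from I v) in
  to I p , trans (cong (to I ∘ σ) (strictlyInverseʳ I p))
                 (trans (cong (to I) σp≡) (strictlyInverseˡ I v))

record Decomposition (T P : Set) (σ : P → P) (V : Set) : Set where
  field
    factor   : T → P ↔ V
    loopless : ∀ s u → conjugate (factor s) σ u ≢ u
    covers   : ∀ {u v} → u ≢ v → ∃[ s ] conjugate (factor s) σ u ≡ v
    unique   : ∀ {s s′} u → conjugate (factor s) σ u ≡ conjugate (factor s′) σ u → s ≡ s′

module _ {σ : P → P} where

  relabelVertices : V ↔ W → Decomposition T P σ V → Decomposition T P σ W
  relabelVertices R D = record
    { factor   = λ s → ↔-trans (factor s) R
    ; loopless = λ s u eq → loopless s (from R u) (to-injective R (trans eq (sym (strictlyInverseˡ R u))))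
    ; covers   = λ {u} {v} u≢v →
        let s , eq = covers (u≢v ∘ from-injective R) in
        s , trans (cong (to R) eq) (strictlyInverseˡ R v)
    ; unique   = λ u eq → unique (from R u) (to-injective R eq)
    }
    where open Decomposition D

  reindexFactors : T ↔ T′ → Decomposition T P σ V → Decomposition T′ P σ V
  reindexFactors R D = record
    { factor   = factor ∘ from R
    ; loopless = loopless ∘ from R
    ; covers   = λ {u} {v} u≢v →
        let s , eq = covers u≢v in
        to R s , subst (λ s → conjugate (factor s) σ u ≡ v) (sym (strictlyInverseʳ R s)) eq
    ; unique   = λ u eq → from-injective R (unique u eq)
    }
    where open Decomposition D

positions : CycleFactor n ms → Pos ms ↔ Fin n
positions F = ⤖⇒↔ (mk⤖ (CycleFactor.spanning-disjoint F))

cycleFactor : Pos ms ↔ Fin n → CycleFactor n ms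
cycleFactor I = record
  { vert = λ j i → to I (j , i)
  ; spanning-disjoint = Bijection.bijective (↔⇒⤖ I)
  }

-- HasArc F is definitionally HasArc (cycleFactor (positions F)), so the next
-- two lemmas also describe the arcs of an arbitrary cycle factor.

hasArc⇒conjugate : ∀ (I : Pos ms ↔ Fin n) {u v} →
                   HasArc (cycleFactor {ms = ms} I) u v → conjugate I (nextPos ms) u ≡ v
hasArc⇒conjugate {ms = ms} I (j , i , refl , refl) = cong (to I ∘ nextPos ms) (strictlyInverseʳ I (j , i))

conjugate⇒hasArc : ∀ (I : Pos ms ↔ Fin n) u →
                   HasArc (cycleFactor {ms = ms} I) u (conjugate I (nextPos ms) u)
conjugate⇒hasArc I u = proj₁ (from I u) , proj₂ (from I u) , strictlyInverseˡ I u , refl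

Solution⇒Decomposition : Solution ms → ∃[ t ] Decomposition (Fin t) (Pos ms) (nextPos ms) (Fin (sum ms))
Solution⇒Decomposition {ms} (t , F , loopless , covers) = t , record
  { factor   = I
  ; loopless = λ s u → loopless s u _ (arc s u) ∘ sym
  ; covers   = λ u≢v → let s , s∋uv , _ = covers _ _ u≢v in s , hasArc⇒conjugate {ms} (I s) s∋uv
  ; unique   = λ {s} {s′} u eq →
      let _ , _ , owner = covers u _ (loopless s u _ (arc s u)) in
      trans (owner s (arc s u)) (sym (owner s′ (subst (HasArc (F s′) u) (sym eq) (arc s′ u))))
  }
  where
  I = positions ∘ F
  arc : ∀ s u → HasArc (F s) u (conjugate (I s) (nextPos ms) u)
  arc s = conjugate⇒hasArc {ms} (I s)

Decomposition⇒Solution : Decomposition (Fin t) (Pos ms) (nextPos ms) (Fin (sum ms)) → Solution ms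
Decomposition⇒Solution {t} {ms} D =
  t , cycleFactor ∘ factor
  , (λ s u v s∋uv u≡v → loopless s u (trans (hasArc⇒conjugate {ms} (factor s) s∋uv) (sym u≡v)))
  , λ u v u≢v →
      let s , eq = covers u≢v in
      s , subst (HasArc (cycleFactor {ms} (factor s)) u) eq (conjugate⇒hasArc {ms} (factor s) u)
        , λ s′ s′∋uv → unique u (trans (hasArc⇒conjugate {ms} (factor s′) s′∋uv) (sym eq))
  where open Decomposition D

Solution-empty : sum ms ≡ 0 → Solution ms
Solution-empty empty = 0 , (λ ()) , (λ ()) , λ u _ _ → ⊥-elim (¬Fin0 (subst Fin empty u))

-- arcOwner (s , x) pairs x with the factor of DB containing the arc by which
-- factor s of DA leaves x; so factors × vertices of either decomposition
-- enumerate the arcs of K*_V, which fixes the number of factors.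

module _ {σA : PA → PA} {σB : PB → PB}
         (DA : Decomposition T PA σA V) (DB : Decomposition T′ PB σB V) where

  private
    module A = Decomposition DA
    module B = Decomposition DB

  arcOwner : T × V → T′ × V
  arcOwner (s , x) = proj₁ (B.covers (A.loopless s x ∘ sym)) , x

  arcOwner-injective : Injective _≡_ _≡_ arcOwner
  arcOwner-injective {s , x} {s′ , x′} eq with ,-injectiveʳ eq
  ... | refl = cong (_, x) (A.unique x (begin
      conjugate (A.factor s) σA x           ≡⟨ owns s ⟨
      conjugate (B.factor (owner s)) σB x   ≡⟨ cong (λ r → conjugate (B.factor r) σB x) (,-injectiveˡ eq) ⟩
      conjugate (B.factor (owner s′)) σB x  ≡⟨ owns s′ ⟩
      conjugate (A.factor s′) σA x          ∎))
    where
    open ≡-Reasoning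
    owner : T → T′
    owner s = proj₁ (arcOwner (s , x))
    owns : ∀ s → conjugate (B.factor (owner s)) σB x ≡ conjugate (A.factor s) σA x
    owns s = proj₂ (B.covers (A.loopless s x ∘ sym))

arcOwner↣ : ∀ {σA : PA → PA} {σB : PB → PB} →
            Decomposition (Fin t) PA σA (Fin n) → Decomposition (Fin m) PB σB (Fin n) →
            Fin (t * n) ↣ Fin (m * n)
arcOwner↣ DA DB =
  ↣-trans (↔⇒↣ *↔×) (↣-trans (mk↣ (arcOwner-injective DA DB)) (↔⇒↣ (↔-sym *↔×)))

factorCount-unique : ∀ {σA : PA → PA} {σB : PB → PB} →
                     Decomposition (Fin t) PA σA (Fin (suc n)) →
                     Decomposition (Fin m) PB σB (Fin (suc n)) → t ≡ m
factorCount-unique {t = t} {n} {m} DA DB = *-cancelʳ-≡ t m (suc n)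
  (cantor-schröder-bernstein (Injection.injective (arcOwner↣ DA DB))
                             (Injection.injective (arcOwner↣ DB DA)))

record LatinSquare (V : Set) : Set where
  infixl 7 _∙_
  field
    _∙_          : V → V → V
    ∙-bijectiveˡ : ∀ x → Bijective _≡_ _≡_ (x ∙_)
    ∙-bijectiveʳ : ∀ y → Bijective _≡_ _≡_ (_∙ y)

  ∙-cancelˡ : ∀ x → Injective _≡_ _≡_ (x ∙_)
  ∙-cancelˡ x = proj₁ (∙-bijectiveˡ x)

  ∙-solveˡ : ∀ x z → ∃[ d ] x ∙ d ≡ z
  ∙-solveˡ x z = let d , x∙d≡z = proj₂ (∙-bijectiveˡ x) z in d , x∙d≡z refl

  row : V → V ↔ V
  row y = ⤖⇒↔ (mk⤖ (∙-bijectiveʳ y))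

[m%d+n]%d≡[m+n]%d : ∀ m n d .{{_ : NonZero d}} → (m % d + n) % d ≡ (m + n) % d
[m%d+n]%d≡[m+n]%d m n d = begin
  (m % d + n) % d           ≡⟨ %-distribˡ-+ (m % d) n d ⟩
  (m % d % d + n % d) % d   ≡⟨ cong (λ k → (k + n % d) % d) (m%n%n≡m%n m d) ⟩
  (m % d + n % d) % d       ≡⟨ %-distribˡ-+ m n d ⟨
  (m + n) % d               ∎
  where open ≡-Reasoning

[m+n%d]%d≡[m+n]%d : ∀ m n d .{{_ : NonZero d}} → (m + n % d) % d ≡ (m + n) % d
[m+n%d]%d≡[m+n]%d m n d = begin
  (m + n % d) % d   ≡⟨ cong (_% d) (+-comm m (n % d)) ⟩
  (n % d + m) % d   ≡⟨ [m%d+n]%d≡[m+n]%d n m d ⟩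
  (n + m) % d       ≡⟨ cong (_% d) (+-comm n m) ⟩
  (m + n) % d       ∎
  where open ≡-Reasoning

module CyclicGroup (n : ℕ) where

  N : ℕ
  N = suc n

  infixl 6 _⊕_
  _⊕_ : Fin N → Fin N → Fin N
  x ⊕ y = (toℕ x + toℕ y) mod N

  ⊖_ : Fin N → Fin N
  ⊖ x = (N ∸ toℕ x) mod N

  private
    mod-cong : ∀ k l → k % N ≡ l % N → k mod N ≡ l mod N
    mod-cong k l eq = toℕ-injective (trans (toℕ-mod k N) (trans eq (sym (toℕ-mod l N))))

  ⊕-comm : ∀ x y → x ⊕ y ≡ y ⊕ x
  ⊕-comm x y = cong (_mod N) (+-comm (toℕ x) (toℕ y))

  ⊕-assoc : ∀ x y z → (x ⊕ y) ⊕ z ≡ x ⊕ (y ⊕ z)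
  ⊕-assoc x y z = mod-cong (toℕ (x ⊕ y) + toℕ z) (toℕ x + toℕ (y ⊕ z)) (begin
    (toℕ (x ⊕ y) + toℕ z) % N          ≡⟨ cong (λ k → (k + toℕ z) % N) (toℕ-mod (toℕ x + toℕ y) N) ⟩
    ((toℕ x + toℕ y) % N + toℕ z) % N  ≡⟨ [m%d+n]%d≡[m+n]%d (toℕ x + toℕ y) (toℕ z) N ⟩
    (toℕ x + toℕ y + toℕ z) % N        ≡⟨ cong (_% N) (+-assoc (toℕ x) (toℕ y) (toℕ z)) ⟩
    (toℕ x + (toℕ y + toℕ z)) % N      ≡⟨ [m+n%d]%d≡[m+n]%d (toℕ x) (toℕ y + toℕ z) N ⟨
    (toℕ x + (toℕ y + toℕ z) % N) % N  ≡⟨ cong (λ k → (toℕ x + k) % N) (toℕ-mod (toℕ y + toℕ z) N) ⟨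
    (toℕ x + toℕ (y ⊕ z)) % N          ∎)
    where open ≡-Reasoning

  ⊕-identityˡ : ∀ y → zero ⊕ y ≡ y
  ⊕-identityˡ y = toℕ-injective (trans (toℕ-mod (toℕ y) N) (m<n⇒m%n≡m (toℕ<n y)))

  ⊖-inverseˡ : ∀ x → ⊖ x ⊕ x ≡ zero
  ⊖-inverseˡ x = mod-cong (toℕ (⊖ x) + toℕ x) 0 (begin
    (toℕ (⊖ x) + toℕ x) % N          ≡⟨ cong (λ k → (k + toℕ x) % N) (toℕ-mod (N ∸ toℕ x) N) ⟩
    ((N ∸ toℕ x) % N + toℕ x) % N    ≡⟨ [m%d+n]%d≡[m+n]%d (N ∸ toℕ x) (toℕ x) N ⟩
    (N ∸ toℕ x + toℕ x) % N          ≡⟨ cong (_% N) (m∸n+n≡m (<⇒≤ (toℕ<n x))) ⟩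
    N % N                            ≡⟨ n%n≡0 N ⟩
    0                                ∎)
    where open ≡-Reasoning

  ⊕-cancelˡ : ∀ x → Injective _≡_ _≡_ (x ⊕_)
  ⊕-cancelˡ x {y} {z} eq = begin
    y                ≡⟨ ⊖-⊕-cancel y ⟨
    ⊖ x ⊕ (x ⊕ y)    ≡⟨ cong (⊖ x ⊕_) eq ⟩
    ⊖ x ⊕ (x ⊕ z)    ≡⟨ ⊖-⊕-cancel z ⟩
    z                ∎
    where
    open ≡-Reasoning
    ⊖-⊕-cancel : ∀ y → ⊖ x ⊕ (x ⊕ y) ≡ y
    ⊖-⊕-cancel y =
      trans (sym (⊕-assoc (⊖ x) x y)) (trans (cong (_⊕ y) (⊖-inverseˡ x)) (⊕-identityˡ y))

  ⊕-solveˡ : ∀ x z → x ⊕ (⊖ x ⊕ z) ≡ z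
  ⊕-solveˡ x z = begin
    x ⊕ (⊖ x ⊕ z)   ≡⟨ ⊕-assoc x (⊖ x) z ⟨
    x ⊕ ⊖ x ⊕ z     ≡⟨ cong (_⊕ z) (⊕-comm x (⊖ x)) ⟩
    ⊖ x ⊕ x ⊕ z     ≡⟨ cong (_⊕ z) (⊖-inverseˡ x) ⟩
    zero ⊕ z        ≡⟨ ⊕-identityˡ z ⟩
    z               ∎
    where open ≡-Reasoning

cyclicLatinSquare : ∀ n → LatinSquare (Fin (suc n))
cyclicLatinSquare n = record
  { _∙_          = _⊕_
  ; ∙-bijectiveˡ = λ x →
      ⊕-cancelˡ x , strictlySurjective⇒surjective (λ z → ⊖ x ⊕ z , ⊕-solveˡ x z)
  ; ∙-bijectiveʳ = λ y →
      (λ {x} {x′} eq → ⊕-cancelˡ y (trans (⊕-comm y x) (trans eq (⊕-comm x′ y))))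
      , strictlySurjective⇒surjective (λ z → ⊖ y ⊕ z , trans (⊕-comm _ y) (⊕-solveˡ y z))
  }
  where open CyclicGroup n

×Bool↔⊎ : X ↔ Y → (X × Bool) ↔ (X ⊎ Y)
×Bool↔⊎ {X} {Y} R = mk↔ₛ′ to′ from′ to∘from from∘to
  where
  to′ : X × Bool → X ⊎ Y
  to′ (x , false) = inj₁ x
  to′ (y , true)  = inj₂ (to R y)
  from′ : X ⊎ Y → X × Bool
  from′ (inj₁ x) = x , false
  from′ (inj₂ z) = from R z , true
  to∘from : ∀ w → to′ (from′ w) ≡ w
  to∘from (inj₁ x) = refl
  to∘from (inj₂ z) = cong inj₂ (strictlyInverseˡ R z)
  from∘to : ∀ w → from′ (to′ w) ≡ w
  from∘to (x , false) = refl
  from∘to (y , true)  = cong (_, true) (strictlyInverseʳ R y)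

-- Factor inj₁ s runs the s-th factors of DA and DB side by side on the two
-- copies of V; factor inj₂ d is the bicoloured factor with its second colour
-- class moved by _∙ d, so it only uses arcs between the copies.

module Combination
  {T PA PB P V : Set} {σA : PA → PA} {σB : PB → PB} {σ : P → P}
  (L : LatinSquare V)
  (DA : Decomposition T PA σA V) (DB : Decomposition T PB σB V)
  (split : P ↔ (PA ⊎ PB))
  (split-σ : ∀ p → to split (σ p) ≡ Sum.map σA σB (to split p))
  (colouring : P ↔ (V × Bool))
  (colour-σ : ∀ p → proj₂ (to colouring (σ p)) ≡ not (proj₂ (to colouring p)))
  (σ-injective : Injective _≡_ _≡_ σ)
  (σ-surjective : StrictlySurjective _≡_ σ)
  where

  open LatinSquare L
  private
    module A = Decomposition DA
    module B = Decomposition DB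

    alternate : V × Bool → V × Bool
    alternate = conjugate colouring σ

  cross : Bool → V → V
  cross b x = proj₁ (alternate (x , b))

  alternate-cross : ∀ b x → alternate (x , b) ≡ (cross b x , not b)
  alternate-cross b x =
    cong (cross b x ,_) (trans (colour-σ _) (cong (not ∘ proj₂) (strictlyInverseˡ colouring (x , b))))

  cross-injective : Injective _≡_ _≡_ (cross true)
  cross-injective {w} {w′} eq = ,-injectiveˡ (conjugate-injective colouring σ-injective (begin
    alternate (w , true)     ≡⟨ alternate-cross true w ⟩
    (cross true w , false)   ≡⟨ cong (_, false) eq ⟩
    (cross true w′ , false)  ≡⟨ alternate-cross true w′ ⟨
    alternate (w′ , true)    ∎))
    where open ≡-Reasoning

  cross-surjective : StrictlySurjective _≡_ (cross true)
  cross-surjective z with conjugate-surjective colouring σ-surjective (z , false)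
  ... | (w , true) , eq = w , cong proj₁ eq
  ... | (w , false) , eq with () ← trans (sym (cong proj₂ (alternate-cross false w))) (cong proj₂ eq)

  factor : T ⊎ V → P ↔ (V ⊎ V)
  factor (inj₁ s) = ↔-trans split (A.factor s ⊎-↔ B.factor s)
  factor (inj₂ d) = ↔-trans colouring (×Bool↔⊎ (row d))

  successor : T ⊎ V → V ⊎ V → V ⊎ V
  successor k = conjugate (factor k) σ

  successor-inside : ∀ s w →
    successor (inj₁ s) w ≡ Sum.map (conjugate (A.factor s) σA) (conjugate (B.factor s) σB) w
  successor-inside s (inj₁ x) = cong (Sum.map (to (A.factor s)) (to (B.factor s)))
    (trans (split-σ _) (cong (Sum.map σA σB) (strictlyInverseˡ split _)))
  successor-inside s (inj₂ y) = cong (Sum.map (to (A.factor s)) (to (B.factor s)))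
    (trans (split-σ _) (cong (Sum.map σA σB) (strictlyInverseˡ split _)))

  successor-across₁ : ∀ d x → successor (inj₂ d) (inj₁ x) ≡ inj₂ (cross false x ∙ d)
  successor-across₁ d x = cong (to (×Bool↔⊎ (row d))) (alternate-cross false x)

  successor-across₂ : ∀ d y → successor (inj₂ d) (inj₂ y) ≡ inj₁ (cross true (from (row d) y))
  successor-across₂ d y = cong (to (×Bool↔⊎ (row d))) (alternate-cross true _)

  loopless : ∀ k u → successor k u ≢ u
  loopless (inj₁ s) (inj₁ x) eq =
    A.loopless s x (inj₁-injective (trans (sym (successor-inside s (inj₁ x))) eq))
  loopless (inj₁ s) (inj₂ y) eq =
    B.loopless s y (inj₂-injective (trans (sym (successor-inside s (inj₂ y))) eq))
  loopless (inj₂ d) (inj₁ x) eq with () ← trans (sym (successor-across₁ d x)) eq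
  loopless (inj₂ d) (inj₂ y) eq with () ← trans (sym (successor-across₂ d y)) eq

  covers : ∀ {u v} → u ≢ v → ∃[ k ] successor k u ≡ v
  covers {inj₁ x} {inj₁ z} x≢z =
    let s , eq = A.covers (x≢z ∘ cong inj₁) in
    inj₁ s , trans (successor-inside s (inj₁ x)) (cong inj₁ eq)
  covers {inj₂ y} {inj₂ z} y≢z =
    let s , eq = B.covers (y≢z ∘ cong inj₂) in
    inj₁ s , trans (successor-inside s (inj₂ y)) (cong inj₂ eq)
  covers {inj₁ x} {inj₂ y} _ =
    let d , eq = ∙-solveˡ (cross false x) y in
    inj₂ d , trans (successor-across₁ d x) (cong inj₂ eq)
  covers {inj₂ y} {inj₁ z} _ =
    let w , w↦z = cross-surjective z
        d , w∙d≡y = ∙-solveˡ w y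
        w≡ = trans (cong (from (row d)) (sym w∙d≡y)) (strictlyInverseʳ (row d) w)
    in inj₂ d , trans (successor-across₂ d y) (cong inj₁ (trans (cong (cross true) w≡) w↦z))

  unique : ∀ {k k′} u → successor k u ≡ successor k′ u → k ≡ k′
  unique {inj₁ s} {inj₁ s′} w@(inj₁ x) eq = cong inj₁ (A.unique x
    (inj₁-injective (trans (sym (successor-inside s w)) (trans eq (successor-inside s′ w)))))
  unique {inj₁ s} {inj₁ s′} w@(inj₂ y) eq = cong inj₁ (B.unique y
    (inj₂-injective (trans (sym (successor-inside s w)) (trans eq (successor-inside s′ w)))))
  unique {inj₂ d} {inj₂ d′} (inj₁ x) eq = cong inj₂ (∙-cancelˡ (cross false x)
    (inj₂-injective (trans (sym (successor-across₁ d x)) (trans eq (successor-across₁ d′ x)))))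
  unique {inj₂ d} {inj₂ d′} (inj₂ y) eq = cong inj₂ (∙-cancelˡ (from (row d) y) (begin
    from (row d) y ∙ d    ≡⟨ strictlyInverseˡ (row d) y ⟩
    y                     ≡⟨ strictlyInverseˡ (row d′) y ⟨
    from (row d′) y ∙ d′  ≡⟨ cong (_∙ d′) w≡w′ ⟨
    from (row d) y ∙ d′   ∎))
    where
    open ≡-Reasoning
    w≡w′ : from (row d) y ≡ from (row d′) y
    w≡w′ = cross-injective (inj₁-injective
      (trans (sym (successor-across₂ d y)) (trans eq (successor-across₂ d′ y))))
  unique {inj₁ s} {inj₂ d} w@(inj₁ x) eq
    with () ← trans (sym (successor-inside s w)) (trans eq (successor-across₁ d x))
  unique {inj₁ s} {inj₂ d} w@(inj₂ y) eq
    with () ← trans (sym (successor-inside s w)) (trans eq (successor-across₂ d y))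
  unique {inj₂ d} {inj₁ s} w@(inj₁ x) eq
    with () ← trans (sym (successor-across₁ d x)) (trans eq (successor-inside s w))
  unique {inj₂ d} {inj₁ s} w@(inj₂ y) eq
    with () ← trans (sym (successor-across₂ d y)) (trans eq (successor-inside s w))

  decomposition : Decomposition (T ⊎ V) P σ (V ⊎ V)
  decomposition = record { factor = factor ; loopless = loopless ; covers = covers ; unique = unique }

record Bicolouring (ms : List ℕ) (n : ℕ) : Set where
  field
    colouring   : Pos ms ↔ (Fin n × Bool)
    colour-next : ∀ p → proj₂ (to colouring (nextPos ms p)) ≡ not (proj₂ (to colouring p))

parity : ℕ → Bool
parity zero    = false
parity (suc k) = not (parity k)

parity-even : ∀ c → parity (c * 2) ≡ false
parity-even zero    = refl
parity-even (suc c) = trans (not-involutive _) (parity-even c)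

parity-next : ∀ {c} (i : Fin (c * 2)) → parity (toℕ (next i)) ≡ not (parity (toℕ i))
parity-next {c} i with next-cases i
... | inj₁ i↦i+1 = cong parity i↦i+1
... | inj₂ (i↦0 , i+1≡2c) = trans (cong parity i↦0) (sym (trans (cong parity i+1≡2c) (parity-even c)))

halve : ∀ c → Fin (c * 2) → Fin c × Bool
halve (suc c) zero = zero , false
halve (suc c) (suc zero) = zero , true
halve (suc c) (suc (suc i)) = map₁ Fin.suc (halve c i)

unhalve : ∀ c → Fin c × Bool → Fin (c * 2)
unhalve (suc c) (zero , false) = zero
unhalve (suc c) (zero , true) = suc zero
unhalve (suc c) (suc h , b) = suc (suc (unhalve c (h , b)))

halve-unhalve : ∀ c w → halve c (unhalve c w) ≡ w
halve-unhalve (suc c) (zero , false) = refl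
halve-unhalve (suc c) (zero , true) = refl
halve-unhalve (suc c) (suc h , b) = cong (map₁ Fin.suc) (halve-unhalve c (h , b))

unhalve-halve : ∀ c i → unhalve c (halve c i) ≡ i
unhalve-halve (suc c) zero = refl
unhalve-halve (suc c) (suc zero) = refl
unhalve-halve (suc c) (suc (suc i)) with halve c i | unhalve-halve c i
... | _ | eq = cong (Fin.suc ∘ Fin.suc) eq

halve-parity : ∀ c (i : Fin (c * 2)) → proj₂ (halve c i) ≡ parity (toℕ i)
halve-parity (suc c) zero = refl
halve-parity (suc c) (suc zero) = refl
halve-parity (suc c) (suc (suc i)) = trans (halve-parity c i) (sym (not-involutive _))

evenCycle-bicolouring : ∀ c → Bicolouring [ c * 2 ] c
evenCycle-bicolouring c = record
  { colouring   = mk↔ₛ′ to′ (λ w → zero , unhalve c w) (halve-unhalve c) from∘to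
  ; colour-next = λ { (zero , i) → trans (halve-parity c (next i))
                                    (trans (parity-next {c} i) (cong not (sym (halve-parity c i)))) }
  }
  where
  to′ : Pos [ c * 2 ] → Fin c × Bool
  to′ (zero , i) = halve c i
  from∘to : ∀ p → (zero , unhalve c (to′ p)) ≡ p
  from∘to (zero , i) = cong (zero ,_) (unhalve-halve c i)

Bicolouring-++ : Bicolouring xs m → Bicolouring ys n → Bicolouring (xs ++ ys) (m + n)
Bicolouring-++ {xs} {m} {ys} {n} X Y = record
  { colouring   = colouring
  ; colour-next = colour-next
  }
  where
  module X = Bicolouring X
  module Y = Bicolouring Y
  merge : ((Fin m × Bool) ⊎ (Fin n × Bool)) ↔ (Fin (m + n) × Bool)
  merge = ↔-trans (↔-sym (×-distribʳ-⊎ 0ℓ Bool (Fin m) (Fin n))) (↔-sym +↔⊎ ×-↔ ↔-refl)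
  colouring : Pos (xs ++ ys) ↔ (Fin (m + n) × Bool)
  colouring = ↔-trans (Pos-++ xs ys) (↔-trans (X.colouring ⊎-↔ Y.colouring) merge)
  colour-next : ∀ p → proj₂ (to colouring (nextPos (xs ++ ys) p)) ≡ not (proj₂ (to colouring p))
  colour-next p rewrite splitPos-nextPos xs ys p with splitPos xs ys p
  ... | inj₁ q = X.colour-next q
  ... | inj₂ q = Y.colour-next q

Bicolouring-empty : Bicolouring [] 0
Bicolouring-empty = record
  { colouring = mk↔ₛ′ (λ ()) (λ { (() , _) }) (λ { (() , _) }) (λ ())
  ; colour-next = λ ()
  }

evenCycles-bicolouring : All (2 ∣_) ms → ∃[ h ] h * 2 ≡ sum ms × Bicolouring ms h
evenCycles-bicolouring [] = 0 , refl , Bicolouring-empty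
evenCycles-bicolouring (divides c refl ∷ evens) =
  let h , h*2≡ , colours = evenCycles-bicolouring evens in
  c + h , trans (*-distribʳ-+ 2 c h) (cong (c * 2 +_) h*2≡)
  , Bicolouring-++ (evenCycle-bicolouring c) colours

Decomposition-++ : ∀ {A B} n →
  Decomposition (Fin t) (Pos A) (nextPos A) (Fin (suc n)) →
  Decomposition (Fin t) (Pos B) (nextPos B) (Fin (suc n)) →
  Bicolouring (A ++ B) (suc n) →
  Decomposition (Fin (t + suc n)) (Pos (A ++ B)) (nextPos (A ++ B)) (Fin (suc n + suc n))
Decomposition-++ {A = A} {B} n DA DB colours =
  relabelVertices (↔-sym +↔⊎) (reindexFactors (↔-sym +↔⊎)
    (Combination.decomposition (cyclicLatinSquare n) DA DB (Pos-++ A B) (splitPos-nextPos A B)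
      (Bicolouring.colouring colours) (Bicolouring.colour-next colours)
      (nextPos-injective {A ++ B}) (nextPos-surjective {A ++ B})))

sum-++-≡ : ∀ xs ys → sum xs ≡ m → sum ys ≡ n → sum (xs ++ ys) ≡ m + n
sum-++-≡ xs ys |xs|≡m |ys|≡n = trans (sum-++ xs ys) (cong₂ _+_ |xs|≡m |ys|≡n)

onVertices : ∀ {k l} {T P σ} → k ≡ l → Decomposition T P σ (Fin k) → Decomposition T P σ (Fin l)
onVertices {T = T} {P} {σ} = subst (Decomposition T P σ ∘ Fin)

Solution-++-nonempty : ∀ {A B} n → sum A ≡ suc n → sum B ≡ suc n → All (2 ∣_) (A ++ B) →
                       Solution A → Solution B → Solution (A ++ B)
Solution-++-nonempty {A} {B} n |A|≡N |B|≡N evens solA solB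
  with Solution⇒Decomposition solA | Solution⇒Decomposition solB | evenCycles-bicolouring evens
... | t , DA | t′ , DB | h , h*2≡|A++B| , colours
  with factorCount-unique (onVertices |A|≡N DA) (onVertices |B|≡N DB) | *-cancelʳ-≡ h (suc n) 2 h*2≡N*2
  where
  h*2≡N*2 : h * 2 ≡ suc n * 2
  h*2≡N*2 = trans h*2≡|A++B| (trans (sum-++-≡ A B |A|≡N |B|≡N)
              (sym (trans (*-suc (suc n) 1) (cong (suc n +_) (*-identityʳ (suc n))))))
... | refl | refl = Decomposition⇒Solution (onVertices (sym (sum-++-≡ A B |A|≡N |B|≡N))
      (Decomposition-++ {A = A} {B} n (onVertices |A|≡N DA) (onVertices |B|≡N DB) colours))

Solution-++ : ∀ {A B} → All (2 ∣_) A → All (2 ∣_) B → sum A ≡ sum B →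
              Solution A → Solution B → Solution (A ++ B)
Solution-++ {A} {B} evensA evensB |A|≡|B| solA solB = balanced (sum A) refl (sym |A|≡|B|)
  where
  balanced : ∀ N → sum A ≡ N → sum B ≡ N → Solution (A ++ B)
  balanced zero    |A|≡0 |B|≡0 = Solution-empty (sum-++-≡ A B |A|≡0 |B|≡0)
  balanced (suc n) |A|≡N |B|≡N = Solution-++-nonempty n |A|≡N |B|≡N (++⁺ evensA evensB) solA solB

theorem1p5 : (ℓ : ℕ) (ms : List ℕ) → 1 ≤ ℓ → ℓ < length ms →
    All (λ m → 2 ∣ m × 1 ≤ m) ms →
    sum (take ℓ ms) ≡ sum (drop ℓ ms) →
    OPStar (take ℓ ms) → OPStar (drop ℓ ms) → OPStar ms
theorem1p5 ℓ ms _ _ evens balanced solA solB =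
  subst OPStar (take++drop≡id ℓ ms)
    (Solution-++ (take⁺ ℓ evens′) (drop⁺ ℓ evens′) balanced solA solB)
  where
  evens′ : All (2 ∣_) ms
  evens′ = All.map proj₁ evens
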